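{- Let $G$ be a connected graph in which every block is a clique, let $r\in V(G)$, and let $T$ be a breadth-first search spanning tree of $G$ rooted at $r$. Then for every positive integer $k$, $\pi_k(G,r)=\pi_k(T,r)$.
   Context: A block of a graph is a maximal subgraph with no cut vertex. A configuration assigns a nonnegative integer number of pebbles to each vertex; a pebbling move takes two pebbles off a vertex and places one pebble on a neighbor. $\pi_k(H,r)$ is the smallest $m$ such that from every configuration of size $m$ on $H$ one can move at least $k$ pebbles to $r$. -}

module Defs where

open import Data.Nat using (ℕ; zero; suc; _+_; _≤_; _<_)
open import Data.Fin using (Fin)
import Data.Fin as F
open import Data.Product using (Σ; ∃; ∃-syntax; _×_; _,_)
open import Data.Sum using (_⊎_)
open import Relation.Nullary using (¬_)
open import Relation.Unary using (Pred; _∈_; _⊆_)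
open import Relation.Binary.PropositionalEquality using (_≡_; _≢_)
open import Relation.Binary.Construct.Closure.ReflexiveTransitive using (Star)
open import Function.Definitions using (Injective)
open import Level using (0ℓ)

record SimpleGraph (n : ℕ) : Set₁ where
  field
    Adj    : Fin n → Fin n → Set
    sym    : ∀ {u v} → Adj u v → Adj v u
    irrefl : ∀ {v} → ¬ Adj v v
open SimpleGraph public

module _ {n : ℕ} (G : SimpleGraph n) where

  Connected : Set
  Connected = ∀ u v → Star (Adj G) u v

  data PathIn (S : Pred (Fin n) 0ℓ) : Fin n → Fin n → Set where
    here : ∀ {u} → u ∈ S → PathIn S u u
    step : ∀ {u w v} → u ∈ S → Adj G u w → PathIn S w v → PathIn S u v

  ConnectedIn : Pred (Fin n) 0ℓ → Set
  ConnectedIn S = ∀ u v → u ∈ S → v ∈ S → PathIn S u v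

  _minus_ : Pred (Fin n) 0ℓ → Fin n → Pred (Fin n) 0ℓ
  (S minus x) y = y ∈ S × y ≢ x

  NoCutVertex : Pred (Fin n) 0ℓ → Set
  NoCutVertex S = ConnectedIn S × (∀ x → x ∈ S → ConnectedIn (S minus x))

  IsBlock : Pred (Fin n) 0ℓ → Set₁
  IsBlock S = NoCutVertex S × (∀ (S' : Pred (Fin n) 0ℓ) → S ⊆ S' → NoCutVertex S' → S' ⊆ S)

  IsClique : Pred (Fin n) 0ℓ → Set
  IsClique S = ∀ u v → u ∈ S → v ∈ S → u ≢ v → Adj G u v

  EveryBlockClique : Set₁
  EveryBlockClique = ∀ (S : Pred (Fin n) 0ℓ) → IsBlock S → IsClique S

  EarliestNbr : (Fin n → Fin n) → Fin n → Fin n → Set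
  EarliestNbr pos v p = Adj G p v × (∀ w → Adj G w v → pos p F.≤ pos w)

  -- T is a breadth-first search spanning tree of G rooted at r:
  -- there is a BFS visiting order pos (injective, r first, every non-root
  -- vertex's parent = its earliest neighbour, which comes before it, and parents
  -- are visited in nondecreasing order), and the edges of T are exactly the
  -- vertex–parent pairs.
  IsBFSTree : Fin n → SimpleGraph n → Set
  IsBFSTree r T = Σ (Fin n → Fin n) λ pos →
      Injective _≡_ _≡_ pos
    × (∀ v → v ≢ r → pos r F.< pos v)
    × (∀ v → v ≢ r → ∃[ p ] (EarliestNbr pos v p × pos p F.< pos v))
    × (∀ u v pu pv → u ≢ r → v ≢ r → EarliestNbr pos u pu → EarliestNbr pos v pv →
         pos u F.< pos v → pos pu F.≤ pos pv)
    × (∀ x y → (Adj T x y →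
                  ((x ≢ r × EarliestNbr pos x y) ⊎ (y ≢ r × EarliestNbr pos y x)))
             × (((x ≢ r × EarliestNbr pos x y) ⊎ (y ≢ r × EarliestNbr pos y x)) →
                  Adj T x y))

Config : ℕ → Set
Config n = Fin n → ℕ

size : ∀ {n} → Config n → ℕ
size {zero}  C = 0
size {suc n} C = C F.zero + size (λ i → C (F.suc i))

module _ {n : ℕ} (G : SimpleGraph n) where

  data Move (C D : Config n) : Set where
    move : ∀ u v → Adj G u v → D u + 2 ≡ C u → D v ≡ suc (C v) →
           (∀ w → w ≢ u → w ≢ v → D w ≡ C w) → Move C D

  Solvable : Fin n → ℕ → ℕ → Set
  Solvable r k m = ∀ (C : Config n) → size C ≡ m →
                   ∃[ D ] (Star Move C D × k ≤ D r)

  IsPebblingNumber : Fin n → ℕ → ℕ → Set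
  IsPebblingNumber r k m = Solvable r k m × (∀ m' → m' < m → ¬ Solvable r k m')

module Submission where

-- Because every block of G is a clique, every edge of G joins a vertex to its BFS parent or joins two
-- siblings: for any other edge xy, the tree paths from the parents of x and y close up into a cycle
-- through x, y and both parents; a cycle has no cut vertex, so it lies in a block, hence in a clique, and
-- then each parent is an earliest neighbour of both x and y, so the parents coincide.
--
-- For a configuration C let the potential Φ(v) = C(v) + Σ ⌊Φ(c)/2⌋ over the children c of v.
-- Pushing pebbles greedily towards the root, last visited vertices first, gathers Φ(r) pebbles at r
-- using tree moves only, while no move of G (to a parent, to a child, or to a sibling) increases Φ(r).
-- So G and T can gather the same number of pebbles at r from every configuration, and
-- π_k(G,r) = π_k(T,r).

open import Defs renaming (sym to adj-sym; irrefl to adj-irrefl)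
open import Data.Bool using (if_then_else_)
open import Data.Empty using (⊥-elim)
open import Data.Fin using (Fin; toℕ) renaming (zero to fzero; suc to fsuc)
import Data.Fin as F
open import Data.Fin.Properties using (_≟_; any?; suc-injective; toℕ-injective; toℕ<n)
open import Data.Fin.Subset using (Subset; inside; outside; _⊆_; _⊂_; _⊃_) renaming (_∈_ to _∈ₛ_)
open import Data.Fin.Subset.Properties using (⊆-trans) renaming (_∈?_ to _∈ₛ?_)
open import Data.Fin.Subset.Induction using (⊃-wellFounded)
open import Data.List using (List; []; _∷_; _++_; [_]; reverse)
open import Data.List.Properties using (unfold-reverse; ++-assoc)
open import Data.List.Membership.Propositional using (_∈_; _∉_)
open import Data.List.Membership.Propositional.Properties using (∈-++⁺ˡ; ∈-++⁺ʳ; ∈-++⁻; ∈-∃++)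
open import Data.List.Relation.Unary.All using ([]; _∷_)
import Data.List.Relation.Unary.All.Properties as Allₚ
open import Data.List.Relation.Unary.All.Properties using (¬Any⇒All¬; All¬⇒¬Any)
open import Data.List.Relation.Unary.AllPairs using ([]; _∷_)
open import Data.List.Relation.Unary.Any using (here; there)
open import Data.List.Relation.Unary.Any.Properties using (reverse⁻)
open import Data.List.Relation.Unary.Unique.Propositional using (Unique)
open import Data.Nat using (ℕ; zero; suc; _+_; _∸_; _⊔_; _≤_; _<_; z≤n; s≤s; ⌊_/2⌋; _≤?_)
open import Data.Nat.Induction using (<-wellFounded)
open import Data.Nat.Properties hiding (_≟_; suc-injective)
open import Algebra.Properties.CommutativeSemigroup +-commutativeSemigroup using (x∙yz≈y∙xz)
import Data.Nat.Properties as ℕₚ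
open import Data.Product using (∃-syntax; _×_; _,_; proj₁; proj₂)
open import Data.Sum using (_⊎_; inj₁; inj₂)
open import Data.Vec using (tabulate)
open import Data.Vec.Properties using (lookup⇒[]=; []=⇒lookup; lookup∘tabulate)
open import Function using (_∘_; id)
open import Function.Definitions using (Injective)
open import Induction.WellFounded using (WellFounded; module Subrelation; module All)
open import Level using (0ℓ)
import Relation.Binary.Construct.On as On
open import Relation.Binary.Construct.Closure.ReflexiveTransitive using (Star; ε; _◅_; _◅◅_) renaming (map to mapStar)
open import Relation.Binary.Definitions using (tri<; tri≈; tri>)
open import Relation.Binary.PropositionalEquality hiding ([_])
open import Relation.Nullary using (¬_; Dec; yes; no; ¬?; does)
open import Relation.Nullary.Decidable using (_×-dec_; decidable-stable; ¬¬-excluded-middle)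
open import Relation.Unary using (Pred; Decidable)

-- Configurations and moves

⌊1+n/2⌋≤1+⌊n/2⌋ : ∀ m → ⌊ suc m /2⌋ ≤ suc ⌊ m /2⌋
⌊1+n/2⌋≤1+⌊n/2⌋ zero          = z≤n
⌊1+n/2⌋≤1+⌊n/2⌋ (suc zero)    = s≤s z≤n
⌊1+n/2⌋≤1+⌊n/2⌋ (suc (suc m)) = s≤s (⌊1+n/2⌋≤1+⌊n/2⌋ m)

size-mono : ∀ {n} {f g : Config n} → (∀ i → f i ≤ g i) → size f ≤ size g
size-mono {zero}  f≤g = z≤n
size-mono {suc n} f≤g = +-mono-≤ (f≤g fzero) (size-mono (f≤g ∘ fsuc))

size-zero : ∀ {n} {f : Config n} → (∀ i → f i ≡ 0) → size f ≡ 0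
size-zero {zero}  _   = refl
size-zero {suc n} f≡0 = cong₂ _+_ (f≡0 fzero) (size-zero (f≡0 ∘ fsuc))

size-cong : ∀ {n} {f g : Config n} → (∀ i → f i ≡ g i) → size f ≡ size g
size-cong f≡g = ≤-antisym (size-mono (≤-reflexive ∘ f≡g)) (size-mono (≤-reflexive ∘ sym ∘ f≡g))

size-≤-except : ∀ {n} {f g : Config n} x {a b} → (∀ i → i ≢ x → f i ≤ g i) →
  a + f x ≤ b + g x → a + size f ≤ b + size g
size-≤-except {suc n} {f} {g} fzero {a} {b} f≤g at-x = begin
  a + (f fzero + size (f ∘ fsuc)) ≡⟨ +-assoc a _ _ ⟨
  a + f fzero + size (f ∘ fsuc)   ≤⟨ +-mono-≤ at-x (size-mono λ i → f≤g (fsuc i) λ ()) ⟩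
  b + g fzero + size (g ∘ fsuc)   ≡⟨ +-assoc b _ _ ⟩
  b + (g fzero + size (g ∘ fsuc)) ∎
  where open ≤-Reasoning
size-≤-except {suc n} {f} {g} (fsuc x) {a} {b} f≤g at-x = begin
  a + (f fzero + size (f ∘ fsuc)) ≡⟨ x∙yz≈y∙xz a (f fzero) _ ⟩
  f fzero + (a + size (f ∘ fsuc)) ≤⟨ +-mono-≤ (f≤g fzero λ ()) (size-≤-except x (λ i i≢x → f≤g (fsuc i) (i≢x ∘ suc-injective)) at-x) ⟩
  g fzero + (b + size (g ∘ fsuc)) ≡⟨ x∙yz≈y∙xz b (g fzero) _ ⟨
  b + (g fzero + size (g ∘ fsuc)) ∎
  where open ≤-Reasoning

size-≡-except : ∀ {n} {f g : Config n} x {a b} → (∀ i → i ≢ x → f i ≡ g i) →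
  a + f x ≡ b + g x → a + size f ≡ b + size g
size-≡-except x f≡g at-x = ≤-antisym
  (size-≤-except x (λ i i≢x → ≤-reflexive (f≡g i i≢x)) (≤-reflexive at-x))
  (size-≤-except x (λ i i≢x → ≤-reflexive (sym (f≡g i i≢x))) (≤-reflexive (sym at-x)))

module _ {n : ℕ} where

  moveOnce : Fin n → Fin n → Config n → Config n
  moveOnce u v C w with w ≟ u | w ≟ v
  ... | yes _ | _     = C w ∸ 2
  ... | no _  | yes _ = suc (C w)
  ... | no _  | no _  = C w

  moveOnce-source : ∀ {u v} C → moveOnce u v C u ≡ C u ∸ 2
  moveOnce-source {u} {v} C with u ≟ u
  ... | yes _  = refl
  ... | no u≢u = ⊥-elim (u≢u refl)

  moveOnce-target : ∀ {u v} C → v ≢ u → moveOnce u v C v ≡ suc (C v)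
  moveOnce-target {u} {v} C v≢u with v ≟ u | v ≟ v
  ... | yes v≡u | _      = ⊥-elim (v≢u v≡u)
  ... | no _    | yes _  = refl
  ... | no _    | no v≢v = ⊥-elim (v≢v refl)

  moveOnce-other : ∀ {u v w} C → w ≢ u → w ≢ v → moveOnce u v C w ≡ C w
  moveOnce-other {u} {v} {w} C w≢u w≢v with w ≟ u | w ≟ v
  ... | yes w≡u | _       = ⊥-elim (w≢u w≡u)
  ... | no _    | yes w≡v = ⊥-elim (w≢v w≡v)
  ... | no _    | no _    = refl

  moveOnce-isMove : ∀ (H : SimpleGraph n) {u v} C → Adj H u v → 2 ≤ C u → Move H C (moveOnce u v C)
  moveOnce-isMove H {u} {v} C uv 2≤Cu = move u v uv
    (trans (cong (_+ 2) (moveOnce-source {u} {v} C)) (m∸n+n≡m 2≤Cu))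
    (moveOnce-target C λ { refl → adj-irrefl H uv })
    (λ w → moveOnce-other C)

  transfer : Fin n → Fin n → ℕ → Config n → Config n
  transfer u v zero    C = C
  transfer u v (suc q) C = moveOnce u v (transfer u v q C)

  transfer-source : ∀ {u v} q C → transfer u v q C u ≡ C u ∸ (q + q)
  transfer-source zero    C = refl
  transfer-source {u} {v} (suc q) C = begin
    moveOnce u v (transfer u v q C) u  ≡⟨ moveOnce-source {u} {v} (transfer u v q C) ⟩
    transfer u v q C u ∸ 2             ≡⟨ cong (_∸ 2) (transfer-source q C) ⟩
    C u ∸ (q + q) ∸ 2                  ≡⟨ ∸-+-assoc (C u) (q + q) 2 ⟩
    C u ∸ (q + q + 2)                  ≡⟨ cong (C u ∸_) (trans (+-comm (q + q) 2) (sym (cong suc (+-suc q q)))) ⟩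
    C u ∸ (suc q + suc q)              ∎
    where open ≡-Reasoning

  transfer-target : ∀ {u v} q C → v ≢ u → transfer u v q C v ≡ C v + q
  transfer-target zero    C _   = sym (+-identityʳ _)
  transfer-target {u} {v} (suc q) C v≢u =
    trans (moveOnce-target (transfer u v q C) v≢u) (trans (cong suc (transfer-target q C v≢u)) (sym (+-suc _ q)))

  transfer-other : ∀ {u v w} q C → w ≢ u → w ≢ v → transfer u v q C w ≡ C w
  transfer-other zero    C _   _   = refl
  transfer-other {u} {v} (suc q) C w≢u w≢v = trans (moveOnce-other (transfer u v q C) w≢u w≢v) (transfer-other q C w≢u w≢v)

  transfer-moves : ∀ (H : SimpleGraph n) {u v} → Adj H u v → ∀ q C → q + q ≤ C u →
    Star (Move H) C (transfer u v q C)
  transfer-moves H uv zero    C _ = ε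
  transfer-moves H {u} {v} uv (suc q) C 2q+2≤Cu =
    transfer-moves H uv q C (m+n≤o⇒n≤o 2 2+2q≤Cu) ◅◅ (moveOnce-isMove H (transfer u v q C) uv 2≤remaining ◅ ε)
    where
    2+2q≤Cu : 2 + (q + q) ≤ C u
    2+2q≤Cu = subst (_≤ C u) (cong suc (+-suc q q)) 2q+2≤Cu
    2≤remaining : 2 ≤ transfer u v q C u
    2≤remaining = subst (2 ≤_) (sym (transfer-source q C)) (m+n≤o⇒m≤o∸n 2 2+2q≤Cu)
module _ {n : ℕ} {G H : SimpleGraph n} {r : Fin n} {k : ℕ} where

  solvable-supergraph : (∀ {u v} → Adj H u v → Adj G u v) → ∀ {m} → Solvable H r k m → Solvable G r k m
  solvable-supergraph H⊆G solvable C size≡m with solvable C size≡m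
  ... | D , moves , k≤Dr = D , mapStar (λ { (move u v uv e₁ e₂ e₃) → move u v (H⊆G uv) e₁ e₂ e₃ }) moves , k≤Dr

  isPebblingNumber-transport : (∀ {m} → Solvable G r k m → Solvable H r k m) →
    (∀ {m} → Solvable H r k m → Solvable G r k m) →
    ∀ {m} → IsPebblingNumber G r k m → IsPebblingNumber H r k m
  isPebblingNumber-transport G⇒H H⇒G (solvable , minimal) =
    G⇒H solvable , λ m′ m′<m → minimal m′ m′<m ∘ H⇒G

-- Pebbling on a rooted tree whose supergraph only adds sibling edges

data ParentOrSibling {n} (r : Fin n) (parent : Fin n → Fin n) (u v : Fin n) : Set where
  toParent  : u ≢ r → parent u ≡ v → ParentOrSibling r parent u v
  toChild   : v ≢ r → parent v ≡ u → ParentOrSibling r parent u v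
  toSibling : u ≢ r → v ≢ r → parent u ≡ parent v → ParentOrSibling r parent u v

module SiblingPebbling {n : ℕ} (G T : SimpleGraph n) (r : Fin n)
  (rank : Fin n → ℕ) (rank-injective : ∀ {u v} → rank u ≡ rank v → u ≡ v) (rank<n : ∀ v → rank v < n)
  (parent : Fin n → Fin n) (parent-rank : ∀ {v} → v ≢ r → rank (parent v) < rank v)
  (parent-adjacent : ∀ {v} → v ≢ r → Adj T v (parent v))
  (T⊆G : ∀ {u v} → Adj T u v → Adj G u v)
  (edge-kind : ∀ {u v} → Adj G u v → ParentOrSibling r parent u v)
  where

  ChildOf : Fin n → Fin n → Set
  ChildOf c v = c ≢ r × parent c ≡ v

  child? : ∀ c v → Dec (ChildOf c v)
  child? c v = ¬? (c ≟ r) ×-dec parent c ≟ v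

  child-rank : ∀ {c v} → ChildOf c v → rank v < rank c
  child-rank (c≢r , refl) = parent-rank c≢r

  childShare : Fin n → Fin n → ℕ → ℕ
  childShare c v k with child? c v
  ... | yes _ = k
  ... | no  _ = 0

  childShare-child : ∀ {c v} k → ChildOf c v → childShare c v k ≡ k
  childShare-child {c} {v} k c∈v with child? c v
  ... | yes _   = refl
  ... | no  c∉v = ⊥-elim (c∉v c∈v)

  childShare-nonchild : ∀ {c v} k → ¬ ChildOf c v → childShare c v k ≡ 0
  childShare-nonchild {c} {v} k c∉v with child? c v
  ... | yes c∈v = ⊥-elim (c∉v c∈v)
  ... | no  _   = refl

  childShare-mono : ∀ {c v a b} → (ChildOf c v → a ≤ b) → childShare c v a ≤ childShare c v b
  childShare-mono {c} {v} a≤b with child? c v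
  ... | yes c∈v = a≤b c∈v
  ... | no  _   = z≤n

  childShare-cong : ∀ {c v a b} → (ChildOf c v → a ≡ b) → childShare c v a ≡ childShare c v b
  childShare-cong {c} {v} a≡b with child? c v
  ... | yes c∈v = a≡b c∈v
  ... | no  _   = refl

  childSum : (Fin n → ℕ) → Fin n → ℕ
  childSum f v = size (λ c → childShare c v ⌊ f c /2⌋)

  childSum-mono : ∀ {f g v} → (∀ {c} → ChildOf c v → f c ≤ g c) → childSum f v ≤ childSum g v
  childSum-mono {f} {g} {v} f≤g = size-mono λ c → childShare-mono {c} {v} (⌊n/2⌋-mono ∘ f≤g)

  potentialWithin : ℕ → Config n → Fin n → ℕ
  potentialWithin zero    C   = C
  potentialWithin (suc t) C v = C v + childSum (potentialWithin t C) v

  potentialWithin-stable : ∀ C {t t′} v → n ≤ t + rank v → n ≤ t′ + rank v →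
    potentialWithin t C v ≡ potentialWithin t′ C v
  potentialWithin-stable C {zero}          v n≤rv _  = ⊥-elim (<⇒≱ (rank<n v) n≤rv)
  potentialWithin-stable C {suc _} {zero}  v _ n≤rv = ⊥-elim (<⇒≱ (rank<n v) n≤rv)
  potentialWithin-stable C {suc t} {suc t′} v enough enough′ =
    cong (C v +_) (size-cong λ c → childShare-cong λ c∈v → cong ⌊_/2⌋
      (potentialWithin-stable C c (descend t enough c∈v) (descend t′ enough′ c∈v)))
    where
    descend : ∀ s {c} → n ≤ suc s + rank v → ChildOf c v → n ≤ s + rank c
    descend s enough c∈v = ≤-trans enough (≤-trans (≤-reflexive (sym (+-suc s (rank v)))) (+-monoʳ-≤ s (child-rank c∈v)))

  potential : Config n → Fin n → ℕ
  potential = potentialWithin (suc n)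

  potential-unfold : ∀ C v → potential C v ≡ C v + childSum (potential C) v
  potential-unfold C v = cong (C v +_) (size-cong λ c → childShare-cong λ _ → cong ⌊_/2⌋
    (potentialWithin-stable C c (m≤m+n n (rank c)) (≤-trans (n≤1+n n) (m≤m+n (suc n) (rank c)))))

  pebbles≤potential : ∀ C v → C v ≤ potential C v
  pebbles≤potential C v = subst (C v ≤_) (sym (potential-unfold C v)) (m≤m+n (C v) _)

  Later : Fin n → Fin n → Set
  Later c w = rank w < rank c

  later-wellFounded : WellFounded Later
  later-wellFounded = Subrelation.wellFounded (λ {c} w<c → ∸-monoʳ-< w<c (<⇒≤ (rank<n c)))
    (On.wellFounded (λ v → n ∸ rank v) <-wellFounded)

  potential-≤ : ∀ {C D w} → D w ≤ C w → (∀ {c} → ChildOf c w → potential D c ≤ potential C c) →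
    potential D w ≤ potential C w
  potential-≤ {C} {D} {w} Dw≤Cw children≤ = subst₂ _≤_ (sym (potential-unfold D w)) (sym (potential-unfold C w))
    (+-mono-≤ Dw≤Cw (childSum-mono children≤))

  potential-≤-except : ∀ {C D} p x → ChildOf x p →
    (∀ w → w ≢ p → w ≢ x → D w ≤ C w) →
    ((∀ {c} → rank p < rank c → c ≢ x → potential D c ≤ potential C c) → potential D p ≤ potential C p) →
    ∀ w → w ≢ x → potential D w ≤ potential C w
  potential-≤-except {C} {D} p x (_ , x↦p) D≤C at-p = All.wfRec later-wellFounded _ _ inductiveStep
    where
    inductiveStep : ∀ w → (∀ {c} → Later c w → c ≢ x → potential D c ≤ potential C c) → w ≢ x → potential D w ≤ potential C w
    inductiveStep w ih w≢x with w ≟ p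
    ... | yes refl = at-p ih
    ... | no  w≢p  = potential-≤ (D≤C w w≢p w≢x) λ c∈w → ih (child-rank c∈w) λ { refl → w≢p (trans (sym (proj₂ c∈w)) x↦p) }

  potential-toParent : ∀ {C D u} → u ≢ r → 2 + D u ≤ C u → D (parent u) ≤ suc (C (parent u)) →
    (∀ w → w ≢ parent u → w ≢ u → D w ≤ C w) → potential D r ≤ potential C r
  potential-toParent {C} {D} {u} u≢r Du≤ Dp≤ D≤C =
    potential-≤-except p u u∈p D≤C atParent r (u≢r ∘ sym)
    where
    p = parent u
    u∈p : ChildOf u p
    u∈p = u≢r , refl
    atParent : (∀ {c} → rank p < rank c → c ≢ u → potential D c ≤ potential C c) →
      potential D p ≤ potential C p
    atParent ih = begin
      potential D p                          ≡⟨ potential-unfold D p ⟩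
      D p + childSum (potential D) p         ≤⟨ +-monoˡ-≤ _ Dp≤ ⟩
      suc (C p + childSum (potential D) p)   ≡⟨ +-suc (C p) _ ⟨
      C p + suc (childSum (potential D) p)   ≤⟨ +-monoʳ-≤ (C p) sums ⟩
      C p + childSum (potential C) p         ≡⟨ potential-unfold C p ⟨
      potential C p                          ∎
      where
      open ≤-Reasoning
      u-drops : 2 + potential D u ≤ potential C u
      u-drops = begin
        2 + potential D u                      ≡⟨ cong (2 +_) (potential-unfold D u) ⟩
        2 + (D u + childSum (potential D) u)   ≡⟨ +-assoc 2 (D u) _ ⟨
        2 + D u + childSum (potential D) u     ≤⟨ +-mono-≤ Du≤ (childSum-mono λ c∈u →
                                                   ih (<-trans (child-rank u∈p) (child-rank c∈u))
                                                      λ { refl → <-irrefl refl (child-rank c∈u) }) ⟩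
        C u + childSum (potential C) u         ≡⟨ potential-unfold C u ⟨
        potential C u                          ∎
      sums : suc (childSum (potential D) p) ≤ childSum (potential C) p
      sums = size-≤-except u (λ c c≢u → childShare-mono λ c∈p → ⌊n/2⌋-mono (ih (child-rank c∈p) c≢u))
        (subst₂ (λ a b → suc a ≤ b) (sym (childShare-child _ u∈p)) (sym (childShare-child _ u∈p))
          (⌊n/2⌋-mono u-drops))

  -- The parent need only lose one pebble, so that the lemma also covers the second half of a sibling move.
  potential-toChild : ∀ {C D p b} → ChildOf b p → suc (D p) ≤ C p → D b ≤ suc (C b) →
    (∀ w → w ≢ p → w ≢ b → D w ≤ C w) → potential D r ≤ potential C r
  potential-toChild {C} {D} {p} {b} b∈p Dp< Db≤ D≤C =
    potential-≤-except p b b∈p D≤C atParent r (proj₁ b∈p ∘ sym)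
    where
    atParent : (∀ {c} → rank p < rank c → c ≢ b → potential D c ≤ potential C c) →
      potential D p ≤ potential C p
    atParent ih = begin
      potential D p                          ≡⟨ potential-unfold D p ⟩
      D p + childSum (potential D) p         ≤⟨ +-monoʳ-≤ (D p) sums ⟩
      D p + suc (childSum (potential C) p)   ≡⟨ +-suc (D p) _ ⟩
      suc (D p) + childSum (potential C) p   ≤⟨ +-monoˡ-≤ _ Dp< ⟩
      C p + childSum (potential C) p         ≡⟨ potential-unfold C p ⟨
      potential C p                          ∎
      where
      open ≤-Reasoning
      b-grows : potential D b ≤ suc (potential C b)
      b-grows = begin
        potential D b                          ≡⟨ potential-unfold D b ⟩
        D b + childSum (potential D) b         ≤⟨ +-mono-≤ Db≤ (childSum-mono λ c∈b →
                                                   ih (<-trans (child-rank b∈p) (child-rank c∈b))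
                                                      λ { refl → <-irrefl refl (child-rank c∈b) }) ⟩
        suc (C b + childSum (potential C) b)   ≡⟨ cong suc (potential-unfold C b) ⟨
        suc (potential C b)                    ∎
      sums : childSum (potential D) p ≤ suc (childSum (potential C) p)
      sums = size-≤-except b (λ c c≢b → childShare-mono λ c∈p → ⌊n/2⌋-mono (ih (child-rank c∈p) c≢b))
        (subst₂ (λ a b → a ≤ suc b) (sym (childShare-child _ b∈p)) (sym (childShare-child _ b∈p))
          (≤-trans (⌊n/2⌋-mono b-grows) (⌊1+n/2⌋≤1+⌊n/2⌋ (potential C b))))

  -- A sibling move u → v is dominated by the tree move u → p followed by sliding one pebble from p to v.
  potential-toSibling : ∀ {C D u v} → Adj G u v → u ≢ r → v ≢ r → parent u ≡ parent v →
    D u + 2 ≡ C u → D v ≡ suc (C v) → (∀ w → w ≢ u → w ≢ v → D w ≡ C w) → potential D r ≤ potential C r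
  potential-toSibling {C} {D} {u} {v} uv u≢r v≢r pu≡pv Du+2≡Cu Dv≡1+Cv D≡C =
    ≤-trans (potential-toChild (v≢r , sym pu≡pv) Dp<Mp Dv≤1+Mv D≤M)
            (potential-toParent u≢r Mu+2≤Cu Mp≤1+Cp M≤C)
    where
    p = parent u
    M = moveOnce u p C
    p≢u : p ≢ u
    p≢u p≡u = <-irrefl (cong rank p≡u) (parent-rank u≢r)
    p≢v : p ≢ v
    p≢v p≡v = <-irrefl (cong rank (trans (sym pu≡pv) p≡v)) (parent-rank v≢r)
    v≢u : v ≢ u
    v≢u refl = adj-irrefl G uv
    Mu≡Du : M u ≡ D u
    Mu≡Du = trans (moveOnce-source {u = u} {v = p} C) (trans (cong (_∸ 2) (sym Du+2≡Cu)) (m+n∸n≡m (D u) 2))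
    Mu+2≤Cu : 2 + M u ≤ C u
    Mu+2≤Cu = ≤-reflexive (trans (cong (2 +_) Mu≡Du) (trans (+-comm 2 (D u)) Du+2≡Cu))
    Mp≤1+Cp : M p ≤ suc (C p)
    Mp≤1+Cp = ≤-reflexive (moveOnce-target C p≢u)
    M≤C : ∀ w → w ≢ p → w ≢ u → M w ≤ C w
    M≤C w w≢p w≢u = ≤-reflexive (moveOnce-other C w≢u w≢p)
    Dp<Mp : suc (D p) ≤ M p
    Dp<Mp = ≤-reflexive (trans (cong suc (D≡C p p≢u p≢v)) (sym (moveOnce-target C p≢u)))
    Dv≤1+Mv : D v ≤ suc (M v)
    Dv≤1+Mv = ≤-reflexive (trans Dv≡1+Cv (cong suc (sym (moveOnce-other C v≢u (p≢v ∘ sym)))))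
    D≤M : ∀ w → w ≢ p → w ≢ v → D w ≤ M w
    D≤M w w≢p w≢v = ≤-reflexive (byCases (w ≟ u))
      where
      byCases : Dec (w ≡ u) → D w ≡ M w
      byCases (yes refl) = sym Mu≡Du
      byCases (no w≢u)   = trans (D≡C w w≢u w≢v) (sym (moveOnce-other C w≢u w≢p))

  move-potential : ∀ {C D} → Move G C D → potential D r ≤ potential C r
  move-potential {C} {D} (move u v uv Du+2≡Cu Dv≡1+Cv D≡C) with edge-kind uv
  ... | toParent u≢r refl = potential-toParent u≢r (≤-reflexive (trans (+-comm 2 (D u)) Du+2≡Cu))
    (≤-reflexive Dv≡1+Cv) λ w w≢v w≢u → ≤-reflexive (D≡C w w≢u w≢v)
  ... | toChild v≢r refl = potential-toChild (v≢r , refl)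
    (subst (suc (D u) ≤_) Du+2≡Cu (≤-trans (≤-reflexive (+-comm 1 (D u))) (+-monoʳ-≤ (D u) (s≤s z≤n))))
    (≤-reflexive Dv≡1+Cv) λ w w≢u w≢v → ≤-reflexive (D≡C w w≢u w≢v)
  ... | toSibling u≢r v≢r pu≡pv = potential-toSibling uv u≢r v≢r pu≡pv Du+2≡Cu Dv≡1+Cv D≡C

  moves-potential : ∀ {C D} → Star (Move G) C D → potential D r ≤ potential C r
  moves-potential ε          = ≤-refl
  moves-potential (m ◅ ms) = ≤-trans (moves-potential ms) (move-potential m)

  -- Vertices are processed in decreasing rank; at stage j each vertex of rank at least j has sent
  -- ⌊Φ/2⌋ pebbles to its parent, and collected j w c records what child c has delivered to w.
  module Greedy (C : Config n) where

    collected : ℕ → Fin n → Fin n → ℕ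
    collected j w c with j ≤? rank c
    ... | yes _ = childShare c w ⌊ potential C c /2⌋
    ... | no  _ = 0

    collected-done : ∀ {j w c} → j ≤ rank c → collected j w c ≡ childShare c w ⌊ potential C c /2⌋
    collected-done {j} {w} {c} j≤c with j ≤? rank c
    ... | yes _   = refl
    ... | no  j≰c = ⊥-elim (j≰c j≤c)

    collected-pending : ∀ {j w c} → rank c < j → collected j w c ≡ 0
    collected-pending {j} {w} {c} c<j with j ≤? rank c
    ... | yes j≤c = ⊥-elim (<⇒≱ c<j j≤c)
    ... | no  _   = refl

    collected-nonchild : ∀ j {w c} → ¬ ChildOf c w → collected j w c ≡ 0
    collected-nonchild j {w} {c} c∉w with j ≤? rank c
    ... | yes _ = childShare-nonchild _ c∉w
    ... | no  _ = refl

    collected-suc : ∀ j {w c} → rank c ≢ j → collected (suc j) w c ≡ collected j w c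
    collected-suc j {w} {c} c≢j with j ≤? rank c | suc j ≤? rank c
    ... | yes _   | yes _    = refl
    ... | no  _   | no  _    = refl
    ... | yes j≤c | no  j≮c  = ⊥-elim (c≢j (≤-antisym (≮⇒≥ j≮c) j≤c))
    ... | no  j≰c | yes j<c  = ⊥-elim (j≰c (<⇒≤ j<c))

    collected-complete : ∀ {j w} → (∀ {c} → ChildOf c w → j ≤ rank c) →
      size (collected j w) ≡ childSum (potential C) w
    collected-complete {j} {w} done = size-cong λ c → byCases c (child? c w)
      where
      byCases : ∀ c → Dec (ChildOf c w) → collected j w c ≡ childShare c w ⌊ potential C c /2⌋
      byCases c (yes c∈w) = collected-done (done c∈w)
      byCases c (no  c∉w) = trans (collected-nonchild j c∉w) (sym (childShare-nonchild _ c∉w))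

    module _ {j v} (v≡j : rank v ≡ j) where

      other-ranks : ∀ {c} → c ≢ v → rank c ≢ j
      other-ranks c≢v c≡j = c≢v (rank-injective (trans c≡j (sym v≡j)))

      collected-parent : v ≢ r →
        ⌊ potential C v /2⌋ + size (collected (suc j) (parent v)) ≡ size (collected j (parent v))
      collected-parent v≢r = size-≡-except v (λ c c≢v → collected-suc j (other-ranks c≢v)) (begin
        ⌊ potential C v /2⌋ + collected (suc j) (parent v) v  ≡⟨ cong (_ +_) (collected-pending (≤-reflexive (cong suc v≡j))) ⟩
        ⌊ potential C v /2⌋ + 0                               ≡⟨ +-identityʳ _ ⟩
        ⌊ potential C v /2⌋                                   ≡⟨ childShare-child _ (v≢r , refl) ⟨
        childShare v (parent v) ⌊ potential C v /2⌋           ≡⟨ collected-done (≤-reflexive (sym v≡j)) ⟨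
        collected j (parent v) v                              ∎)
        where open ≡-Reasoning

      collected-elsewhere : ∀ {w} → w ≢ parent v → size (collected (suc j) w) ≡ size (collected j w)
      collected-elsewhere {w} w≢p = size-cong λ c → byCases c (c ≟ v)
        where
        byCases : ∀ c → Dec (c ≡ v) → collected (suc j) w c ≡ collected j w c
        byCases c (yes refl) = trans (collected-nonchild (suc j) (w≢p ∘ sym ∘ proj₂)) (sym (collected-nonchild j (w≢p ∘ sym ∘ proj₂)))
        byCases c (no c≢v)   = collected-suc j (other-ranks c≢v)

    Invariant : ℕ → Config n → Set
    Invariant j E = ∀ w → rank w < j → E w ≡ C w + size (collected j w)

    Stage : ℕ → Set
    Stage j = ∃[ E ] Star (Move T) C E × Invariant j E

    stage-initial : Stage n
    stage-initial = C , ε , λ w _ →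
      sym (trans (cong (C w +_) (size-zero λ c → collected-pending (rank<n c))) (+-identityʳ (C w)))

    ready : ∀ {j v E} → rank v ≡ j → Invariant (suc j) E → E v ≡ potential C v
    ready {j} {v} {E} v≡j invariant = begin
      E v                                ≡⟨ invariant v (≤-reflexive (cong suc v≡j)) ⟩
      C v + size (collected (suc j) v)   ≡⟨ cong (C v +_) (collected-complete λ c∈v → subst (_< rank _) v≡j (child-rank c∈v)) ⟩
      C v + childSum (potential C) v     ≡⟨ potential-unfold C v ⟨
      potential C v                      ∎
      where open ≡-Reasoning

    push-invariant : ∀ {j v E} → rank v ≡ j → v ≢ r → Invariant (suc j) E →
      Invariant j (transfer v (parent v) ⌊ potential C v /2⌋ E)
    push-invariant {j} {v} {E} v≡j v≢r invariant w w<j with w ≟ parent v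
    ... | yes refl = begin
      transfer v (parent v) q E (parent v)          ≡⟨ transfer-target q E (λ p≡v → <-irrefl (cong rank p≡v) (parent-rank v≢r)) ⟩
      E (parent v) + q                              ≡⟨ cong (_+ q) (invariant (parent v) (m<n⇒m<1+n w<j)) ⟩
      C (parent v) + size (collected (suc j) (parent v)) + q   ≡⟨ +-assoc (C (parent v)) _ q ⟩
      C (parent v) + (size (collected (suc j) (parent v)) + q) ≡⟨ cong (C (parent v) +_) (trans (+-comm _ q) (collected-parent v≡j v≢r)) ⟩
      C (parent v) + size (collected j (parent v))  ∎
      where
      open ≡-Reasoning
      q = ⌊ potential C v /2⌋
    ... | no w≢p = begin
      transfer v (parent v) ⌊ potential C v /2⌋ E w  ≡⟨ transfer-other ⌊ potential C v /2⌋ E (λ { refl → <-irrefl v≡j w<j }) w≢p ⟩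
      E w                                            ≡⟨ invariant w (m<n⇒m<1+n w<j) ⟩
      C w + size (collected (suc j) w)               ≡⟨ cong (C w +_) (collected-elsewhere v≡j w≢p) ⟩
      C w + size (collected j w)                     ∎
      where open ≡-Reasoning

    stage-step : ∀ {j} → rank r < j → Stage (suc j) → Stage j
    stage-step {j} r<j (E , moves , invariant) with any? (λ v → rank v ℕₚ.≟ j)
    ... | no noneAt-j = E , moves , λ w w<j → trans (invariant w (m<n⇒m<1+n w<j))
            (cong (C w +_) (size-cong λ c → collected-suc j λ c≡j → noneAt-j (c , c≡j)))
    ... | yes (v , v≡j) = transfer v (parent v) q E ,
                          moves ◅◅ transfer-moves T (parent-adjacent v≢r) q E 2q≤Ev ,
                          push-invariant v≡j v≢r invariant
      where
      q = ⌊ potential C v /2⌋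
      v≢r : v ≢ r
      v≢r refl = <-irrefl v≡j r<j
      2q≤Ev : q + q ≤ E v
      2q≤Ev = subst (q + q ≤_) (sym (ready v≡j invariant))
        (≤-trans (+-monoʳ-≤ q (⌊n/2⌋≤⌈n/2⌉ (potential C v))) (≤-reflexive (⌊n/2⌋+⌈n/2⌉≡n (potential C v))))

    stages : ∀ d {j} → j + d ≡ n → rank r < j → Stage j
    stages zero    {j} j+0≡n _   = subst Stage (trans (sym j+0≡n) (+-identityʳ j)) stage-initial
    stages (suc d) {j} j+d+1≡n r<j = stage-step r<j (stages d (trans (sym (+-suc j d)) j+d+1≡n) (m<n⇒m<1+n r<j))

    greedy : ∃[ E ] Star (Move T) C E × potential C r ≤ E r
    greedy with stages (n ∸ suc (rank r)) (m+[n∸m]≡n (rank<n r)) ≤-refl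
    ... | E , moves , invariant = E , moves , ≤-reflexive (sym (begin
      E r                                      ≡⟨ invariant r ≤-refl ⟩
      C r + size (collected (suc (rank r)) r)  ≡⟨ cong (C r +_) (collected-complete (child-rank)) ⟩
      C r + childSum (potential C) r           ≡⟨ potential-unfold C r ⟨
      potential C r                            ∎))
      where open ≡-Reasoning

  solvable-onTree : ∀ {k m} → Solvable G r k m → Solvable T r k m
  solvable-onTree {k} solvable C size≡m with solvable C size≡m | Greedy.greedy C
  ... | D , moves , k≤Dr | E , treeMoves , potential≤Er = E , treeMoves , (begin
    k               ≤⟨ k≤Dr ⟩
    D r             ≤⟨ pebbles≤potential D r ⟩
    potential D r   ≤⟨ moves-potential moves ⟩
    potential C r   ≤⟨ potential≤Er ⟩
    E r             ∎)
    where open ≤-Reasoning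

  same-pebblingNumbers : ∀ {k m} →
    (IsPebblingNumber G r k m → IsPebblingNumber T r k m) × (IsPebblingNumber T r k m → IsPebblingNumber G r k m)
  same-pebblingNumbers = isPebblingNumber-transport solvable-onTree (solvable-supergraph T⊆G)
                      , isPebblingNumber-transport (solvable-supergraph T⊆G) solvable-onTree

-- Blocks and cycles

module Connectivity {n : ℕ} (G : SimpleGraph n) where

  pathIn-weaken : ∀ {S S′ : Pred (Fin n) 0ℓ} → (∀ {x} → S x → S′ x) → ∀ {u v} → PathIn G S u v → PathIn G S′ u v
  pathIn-weaken S⊆S′ (here u∈S)        = here (S⊆S′ u∈S)
  pathIn-weaken S⊆S′ (step u∈S uw path) = step (S⊆S′ u∈S) uw (pathIn-weaken S⊆S′ path)

  pathIn-++ : ∀ {S : Pred (Fin n) 0ℓ} {u w v} → PathIn G S u w → PathIn G S w v → PathIn G S u v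
  pathIn-++ (here _)           rest = rest
  pathIn-++ (step u∈S uw path) rest = step u∈S uw (pathIn-++ path rest)

  pathIn-start : ∀ {S : Pred (Fin n) 0ℓ} {u v} → PathIn G S u v → S u
  pathIn-start (here u∈S)     = u∈S
  pathIn-start (step u∈S _ _) = u∈S

  pathIn-reverse : ∀ {S : Pred (Fin n) 0ℓ} {u v} → PathIn G S u v → PathIn G S v u
  pathIn-reverse (here u∈S)         = here u∈S
  pathIn-reverse (step u∈S uw path) = pathIn-++ (pathIn-reverse path) (step (pathIn-start path) (adj-sym G uw) (here u∈S))

  noCutVertex-cong : ∀ {S S′ : Pred (Fin n) 0ℓ} → (∀ {x} → S x → S′ x) → (∀ {x} → S′ x → S x) →
    NoCutVertex G S → NoCutVertex G S′
  noCutVertex-cong S⊆S′ S′⊆S (connected , connected-minus) =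
    (λ u v u∈S′ v∈S′ → pathIn-weaken S⊆S′ (connected u v (S′⊆S u∈S′) (S′⊆S v∈S′))) ,
    λ x x∈S′ u v (u∈S′ , u≢x) (v∈S′ , v≢x) → pathIn-weaken (λ (w∈S , w≢x) → S⊆S′ w∈S , w≢x)
      (connected-minus x (S′⊆S x∈S′) u v (S′⊆S u∈S′ , u≢x) (S′⊆S v∈S′ , v≢x))

module BlockCliques {n : ℕ} (G : SimpleGraph n) where

  open Connectivity G

  toSubset : ∀ {S : Pred (Fin n) 0ℓ} → Decidable S → Subset n
  toSubset S? = tabulate λ x → if does (S? x) then inside else outside

  module _ {S : Pred (Fin n) 0ℓ} (S? : Decidable S) where

    ∈-toSubset⁺ : ∀ {x} → S x → x ∈ₛ toSubset S?
    ∈-toSubset⁺ {x} x∈S = lookup⇒[]= x _ (trans (lookup∘tabulate _ x) side)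
      where
      side : (if does (S? x) then inside else outside) ≡ inside
      side with S? x
      ... | yes _   = refl
      ... | no  x∉S = ⊥-elim (x∉S x∈S)

    ∈-toSubset⁻ : ∀ {x} → x ∈ₛ toSubset S? → S x
    ∈-toSubset⁻ {x} x∈ = side (trans (sym (lookup∘tabulate _ x)) ([]=⇒lookup x∈))
      where
      side : (if does (S? x) then inside else outside) ≡ inside → S x
      side with S? x
      ... | yes x∈S = λ _ → x∈S
      ... | no  _   = λ ()

  ¬¬-decidable : ∀ {m} (S : Pred (Fin m) 0ℓ) → ¬ ¬ Decidable S
  ¬¬-decidable {zero}  S noDecision = noDecision λ ()
  ¬¬-decidable {suc m} S noDecision = ¬¬-excluded-middle λ S0? → ¬¬-decidable (S ∘ fsuc) λ S+? →
    noDecision λ { fzero → S0? ; (fsuc x) → S+? x }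

  2Connected : Subset n → Set
  2Connected p = NoCutVertex G (_∈ₛ p)

  Maximal2Connected : Subset n → Set
  Maximal2Connected p = 2Connected p × (∀ q → p ⊆ q → 2Connected q → q ⊆ p)

  maximal-extension : ∀ p → 2Connected p → ¬ ¬ (∃[ q ] p ⊆ q × Maximal2Connected q)
  maximal-extension = All.wfRec ⊃-wellFounded _ _ extend
    where
    extend : ∀ p → (∀ {q} → q ⊃ p → 2Connected q → ¬ ¬ (∃[ q′ ] q ⊆ q′ × Maximal2Connected q′)) →
      2Connected p → ¬ ¬ (∃[ q ] p ⊆ q × Maximal2Connected q)
    extend p ih p-conn noExtension = ¬¬-excluded-middle {A = ∃[ q ] p ⊂ q × 2Connected q} λ where
      (yes (q , p⊂q , q-conn)) → ih p⊂q q-conn λ (q′ , q⊆q′ , q′-max) →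
        noExtension (q′ , ⊆-trans (proj₁ p⊂q) q⊆q′ , q′-max)
      (no stuck) → noExtension (p , id , p-conn , λ q p⊆q q-conn {x} x∈q →
        decidable-stable (x ∈ₛ? p) λ x∉p → stuck (q , (p⊆q , x , x∈q , x∉p) , q-conn))

  maximal-isBlock : ∀ {p} → Maximal2Connected p → IsBlock G (_∈ₛ p)
  maximal-isBlock {p} (p-conn , maximal) = p-conn , λ S p⊆S S-conn {x} x∈S →
    decidable-stable (x ∈ₛ? p) λ x∉p → ¬¬-decidable S λ S? →
      x∉p (maximal (toSubset S?) (∈-toSubset⁺ S? ∘ p⊆S)
        (noCutVertex-cong (∈-toSubset⁺ S?) (∈-toSubset⁻ S?) S-conn) (∈-toSubset⁺ S? x∈S))

  -- Blocks are maximal among all, possibly undecidable, predicates, so membership in a block and hence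
  -- cliqueness is only available under double negation.
  noCutVertex-clique : EveryBlockClique G → ∀ {S : Pred (Fin n) 0ℓ} → Decidable S →
    NoCutVertex G S → ¬ ¬ IsClique G S
  noCutVertex-clique blocksCliques S? S-conn notClique =
    maximal-extension (toSubset S?) (noCutVertex-cong (∈-toSubset⁺ S?) (∈-toSubset⁻ S?) S-conn)
      λ (q , S⊆q , q-max) → notClique λ u v u∈S v∈S u≢v →
        blocksCliques _ (maximal-isBlock q-max) u v (S⊆q (∈-toSubset⁺ S? u∈S)) (S⊆q (∈-toSubset⁺ S? v∈S)) u≢v

module _ {A : Set} where

  unique-prefix : ∀ (xs : List A) {ys} → Unique (xs ++ ys) → Unique xs
  unique-prefix []       _              = []
  unique-prefix (x ∷ xs) (x∉rest ∷ rest) = Allₚ.++⁻ˡ xs x∉rest ∷ unique-prefix xs rest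

  unique-++ : ∀ (xs : List A) {ys} → Unique xs → Unique ys → (∀ {z} → z ∈ xs → z ∉ ys) → Unique (xs ++ ys)
  unique-++ []       _               unique-ys _        = unique-ys
  unique-++ (x ∷ xs) (x∉xs ∷ unique-xs) unique-ys disjoint =
    Allₚ.++⁺ x∉xs (¬Any⇒All¬ _ (disjoint (here refl))) ∷ unique-++ xs unique-xs unique-ys (disjoint ∘ there)

  unique-split : ∀ (xs : List A) {z ys} → Unique (xs ++ z ∷ ys) → z ∉ xs × z ∉ ys
  unique-split []       (z∉ys ∷ _)      = (λ ()) , All¬⇒¬Any z∉ys
  unique-split (x ∷ xs) (x∉rest ∷ rest) with unique-split xs rest
  ... | z∉xs , z∉ys = (λ { (here refl) → All¬⇒¬Any (Allₚ.++⁻ʳ xs x∉rest) (here refl) ; (there z∈xs) → z∉xs z∈xs }) , z∉ys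

  unique-reverse : ∀ (xs : List A) → Unique xs → Unique (reverse xs)
  unique-reverse []       _               = []
  unique-reverse (x ∷ xs) (x∉xs ∷ unique-xs) = subst Unique (sym (unfold-reverse x xs))
    (unique-++ (reverse xs) (unique-reverse xs unique-xs) ([] ∷ [])
      λ { z∈rxs (here refl) → All¬⇒¬Any x∉xs (reverse⁻ z∈rxs) })

  split-at-first : ∀ {P : A → Set} → (∀ x → Dec (P x)) → ∀ xs {x} → x ∈ xs → P x →
    ∃[ before ] ∃[ m ] ∃[ after ] xs ≡ before ++ m ∷ after × P m × (∀ {y} → y ∈ before → ¬ P y)
  split-at-first P? (y ∷ xs) x∈ Px with P? y
  ... | yes Py = [] , y , xs , refl , Py , λ ()
  split-at-first P? (y ∷ xs) (here refl) Px | no ¬Py = ⊥-elim (¬Py Px)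
  split-at-first P? (y ∷ xs) (there x∈) Px  | no ¬Py with split-at-first P? xs x∈ Px
  ... | before , m , after , refl , Pm , first = y ∷ before , m , after , refl , Pm ,
        λ { (here refl) → ¬Py ; (there y∈) → first y∈ }

module Walks {n : ℕ} (G : SimpleGraph n) where

  open Connectivity G

  -- A Walk lists every visited vertex; an OpenWalk omits the final one, so a cycle is an OpenWalk a a W.
  data Walk : Fin n → Fin n → List (Fin n) → Set where
    stop : ∀ {a} → Walk a a [ a ]
    hop  : ∀ {a b c vs} → Adj G a b → Walk b c vs → Walk a c (a ∷ vs)

  data OpenWalk : Fin n → Fin n → List (Fin n) → Set where
    stop : ∀ {a} → OpenWalk a a []
    hop  : ∀ {a b c vs} → Adj G a b → OpenWalk b c vs → OpenWalk a c (a ∷ vs)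

  openWalk-++ : ∀ {a b c us vs} → OpenWalk a b us → OpenWalk b c vs → OpenWalk a c (us ++ vs)
  openWalk-++ stop        rest = rest
  openWalk-++ (hop ab w) rest = hop ab (openWalk-++ w rest)

  openWalk-++-walk : ∀ {a b c us vs} → OpenWalk a b us → Walk b c vs → Walk a c (us ++ vs)
  openWalk-++-walk stop        rest = rest
  openWalk-++-walk (hop ab w) rest = hop ab (openWalk-++-walk w rest)

  walk-extend : ∀ {a b c vs} → Walk a b vs → Adj G b c → OpenWalk a c vs
  walk-extend stop        bc = hop bc stop
  walk-extend (hop ab w) bc = hop ab (walk-extend w bc)

  walk-reverse : ∀ {a b vs} → Walk a b vs → Walk b a (reverse vs)
  walk-reverse stop                   = stop
  walk-reverse (hop {a = a} {vs = vs} ab w) =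
    subst (Walk _ a) (sym (unfold-reverse a vs)) (openWalk-++-walk (walk-extend (walk-reverse w) (adj-sym G ab)) stop)

  walk-start : ∀ {a b vs} → Walk a b vs → a ∈ vs
  walk-start stop      = here refl
  walk-start (hop _ _) = here refl

  walk-end : ∀ {a b vs} → Walk a b vs → b ∈ vs
  walk-end stop      = here refl
  walk-end (hop _ w) = there (walk-end w)

  walk-prefix : ∀ {a c} before m after → Walk a c (before ++ m ∷ after) → OpenWalk a m before
  walk-prefix []           m after stop       = stop
  walk-prefix []           m after (hop _ _)  = stop
  walk-prefix (_ ∷ [])         m after (hop ab w) = hop ab (walk-prefix [] m after w)
  walk-prefix (_ ∷ b ∷ before) m after (hop ab w) = hop ab (walk-prefix (b ∷ before) m after w)

  openWalk-split : ∀ {a c} before m after → OpenWalk a c (before ++ m ∷ after) →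
    OpenWalk a m before × OpenWalk m c (m ∷ after)
  openWalk-split []           m after (hop ab w) = stop , hop ab w
  openWalk-split (_ ∷ before) m after (hop ab w) = let w₁ , w₂ = openWalk-split before m after w in hop ab w₁ , w₂

  openWalk-reaches : ∀ {S a b vs} → OpenWalk a b vs → (∀ {x} → x ∈ vs → S x) → ∀ {x} → x ∈ vs → PathIn G S a x
  openWalk-reaches (hop ab w) vs⊆S (here refl) = here (vs⊆S (here refl))
  openWalk-reaches (hop ab w) vs⊆S (there x∈)  = step (vs⊆S (here refl)) ab (openWalk-reaches w (vs⊆S ∘ there) x∈)

  openWalk-connected : ∀ {S a b vs} → OpenWalk a b vs → (∀ {x} → x ∈ vs → S x) →
    ∀ {x y} → x ∈ vs → y ∈ vs → PathIn G S x y
  openWalk-connected w vs⊆S x∈ y∈ = pathIn-++ (pathIn-reverse (openWalk-reaches w vs⊆S x∈)) (openWalk-reaches w vs⊆S y∈)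

  -- Removing z from a cycle through z leaves the rest of the cycle, read from z's successor, as a walk.
  cycle-noCutVertex : ∀ {a W} → OpenWalk a a W → Unique W → NoCutVertex G (_∈ W)
  cycle-noCutVertex {W = W} cycle unique-W =
    (λ u v u∈W v∈W → openWalk-connected cycle (λ x∈W → x∈W) u∈W v∈W) ,
    λ z z∈W u v (u∈W , u≢z) (v∈W , v≢z) → withoutZ z∈W u∈W v∈W u≢z v≢z
    where
    withoutZ : ∀ {z u v} → z ∈ W → u ∈ W → v ∈ W → u ≢ z → v ≢ z → PathIn G (λ x → x ∈ W × x ≢ z) u v
    withoutZ {z} z∈W u∈W v∈W u≢z v≢z with ∈-∃++ z∈W
    ... | before , after , refl with openWalk-split before z after cycle
    ... | toZ , hop _ fromZ = openWalk-connected (openWalk-++ fromZ toZ) kept (rest u∈W u≢z) (rest v∈W v≢z)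
      where
      z∉ = unique-split before unique-W
      kept : ∀ {x} → x ∈ after ++ before → x ∈ W × x ≢ z
      kept x∈ with ∈-++⁻ after x∈
      ... | inj₁ x∈after  = ∈-++⁺ʳ before (there x∈after) , λ { refl → proj₂ z∉ x∈after }
      ... | inj₂ x∈before = ∈-++⁺ˡ x∈before , λ { refl → proj₁ z∉ x∈before }
      rest : ∀ {x} → x ∈ W → x ≢ z → x ∈ after ++ before
      rest x∈W x≢z with ∈-++⁻ before x∈W
      ... | inj₁ x∈before         = ∈-++⁺ʳ after x∈before
      ... | inj₂ (here x≡z)       = ⊥-elim (x≢z x≡z)
      ... | inj₂ (there x∈after) = ∈-++⁺ˡ x∈after

-- Breadth-first search trees of graphs whose blocks are cliques

module BFSOrder {n : ℕ} (G : SimpleGraph n) (r : Fin n) (pos : Fin n → Fin n)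
  (pos-injective : Injective _≡_ _≡_ pos)
  (root-first : ∀ v → v ≢ r → pos r F.< pos v)
  (has-parent : ∀ v → v ≢ r → ∃[ p ] (EarliestNbr G pos v p × pos p F.< pos v))
  where

  open Walks G
  open import Data.List.Membership.DecPropositional (_≟_ {n}) using (_∈?_)
  open BlockCliques G using (noCutVertex-clique)

  rank : Fin n → ℕ
  rank v = toℕ (pos v)

  rank-injective : ∀ {u v} → rank u ≡ rank v → u ≡ v
  rank-injective = pos-injective ∘ toℕ-injective

  parent : Fin n → Fin n
  parent v with v ≟ r
  ... | yes _   = r
  ... | no  v≢r = proj₁ (has-parent v v≢r)

  parent-spec : ∀ {v} → v ≢ r → EarliestNbr G pos v (parent v) × rank (parent v) < rank v
  parent-spec {v} v≢r with v ≟ r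
  ... | yes v≡r  = ⊥-elim (v≢r v≡r)
  ... | no  v≢r′ = proj₂ (has-parent v v≢r′)

  parent-adjacent : ∀ {v} → v ≢ r → Adj G (parent v) v
  parent-adjacent = proj₁ ∘ proj₁ ∘ parent-spec

  parent-earliest : ∀ {v w} → v ≢ r → Adj G w v → rank (parent v) ≤ rank w
  parent-earliest v≢r wv = proj₂ (proj₁ (parent-spec v≢r)) _ wv

  parent-rank : ∀ {v} → v ≢ r → rank (parent v) < rank v
  parent-rank = proj₂ ∘ parent-spec

  chain : ℕ → Fin n → List (Fin n)
  chain zero    w = [ w ]
  chain (suc f) w with w ≟ r
  ... | yes _ = [ w ]
  ... | no  _ = w ∷ chain f (parent w)

  chain-walk : ∀ f w → ∃[ t ] Walk w t (chain f w)
  chain-walk zero    w = w , stop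
  chain-walk (suc f) w with w ≟ r
  ... | yes _   = w , stop
  ... | no  w≢r = let t , rest = chain-walk f (parent w) in t , hop (adj-sym G (parent-adjacent w≢r)) rest

  chain-rank : ∀ f w {z} → z ∈ chain f w → rank z ≤ rank w
  chain-rank zero    w (here refl) = ≤-refl
  chain-rank (suc f) w z∈ with w ≟ r | z∈
  ... | yes _   | here refl  = ≤-refl
  ... | no  _   | here refl  = ≤-refl
  ... | no  w≢r | there z∈′ = ≤-trans (chain-rank f (parent w) z∈′) (<⇒≤ (parent-rank w≢r))

  chain-unique : ∀ f w → Unique (chain f w)
  chain-unique zero    w = [] ∷ []
  chain-unique (suc f) w with w ≟ r
  ... | yes _   = [] ∷ []
  ... | no  w≢r = ¬Any⇒All¬ _ (λ w∈ → <-irrefl refl (≤-<-trans (chain-rank f (parent w) w∈) (parent-rank w≢r)))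
                ∷ chain-unique f (parent w)

  chain-root : ∀ f w → rank w ≤ f → r ∈ chain f w
  chain-root zero w w≤0 with w ≟ r
  ... | yes refl = here refl
  ... | no  w≢r  with ≤-trans (root-first w w≢r) w≤0
  ...   | ()
  chain-root (suc f) w w≤f with w ≟ r
  ... | yes refl = here refl
  ... | no  w≢r  = there (chain-root f (parent w) (≤-pred (≤-trans (parent-rank w≢r) w≤f)))

  ancestors : Fin n → List (Fin n)
  ancestors w = chain (rank w) w

  -- Split w's ancestor chain at its first vertex on u's chain (both chains end at r).
  treePath : ∀ u w → ∃[ vs ] Walk u w vs × Unique vs × (∀ {z} → z ∈ vs → rank z ≤ rank u ⊔ rank w)
  treePath u w with split-at-first (λ z → z ∈? ancestors u) (ancestors w) (chain-root _ w ≤-refl) (chain-root _ u ≤-refl)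
  ... | before , m , after , w-chain≡ , m∈u-chain , before∉u-chain with ∈-∃++ m∈u-chain
  ... | beforeᵤ , afterᵤ , u-chain≡ =
    vs , openWalk-++-walk fromU (walk-reverse fromW) , unique-vs , rank-bound
    where
    vs = beforeᵤ ++ reverse (before ++ [ m ])
    u-chain-walk = proj₂ (chain-walk (rank u) u)
    w-chain-walk = proj₂ (chain-walk (rank w) w)
    fromU : OpenWalk u m beforeᵤ
    fromU = walk-prefix beforeᵤ m afterᵤ (subst (Walk u _) u-chain≡ u-chain-walk)
    fromW : Walk w m (before ++ [ m ])
    fromW = openWalk-++-walk (walk-prefix before m after (subst (Walk w _) w-chain≡ w-chain-walk)) stop
    w-chain≡′ : ancestors w ≡ (before ++ [ m ]) ++ after
    w-chain≡′ = trans w-chain≡ (sym (++-assoc before [ m ] after))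
    in-w-chain : ∀ {z} → z ∈ reverse (before ++ [ m ]) → z ∈ ancestors w
    in-w-chain z∈ = subst (_ ∈_) (sym w-chain≡′) (∈-++⁺ˡ (reverse⁻ {xs = before ++ [ m ]} z∈))
    in-u-chain : ∀ {z} → z ∈ beforeᵤ → z ∈ ancestors u
    in-u-chain z∈ = subst (_ ∈_) (sym u-chain≡) (∈-++⁺ˡ z∈)
    unique-vs : Unique vs
    unique-vs = unique-++ beforeᵤ
      (unique-prefix beforeᵤ (subst Unique u-chain≡ (chain-unique (rank u) u)))
      (unique-reverse (before ++ [ m ]) (unique-prefix (before ++ [ m ]) (subst Unique w-chain≡′ (chain-unique (rank w) w))))
      λ z∈beforeᵤ z∈ → case-w (∈-++⁻ before (reverse⁻ {xs = before ++ [ m ]} z∈)) z∈beforeᵤ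
      where
      case-w : ∀ {z} → z ∈ before ⊎ z ∈ [ m ] → z ∉ beforeᵤ
      case-w (inj₁ z∈before)   z∈beforeᵤ = before∉u-chain z∈before (in-u-chain z∈beforeᵤ)
      case-w (inj₂ (here refl)) z∈beforeᵤ = proj₁ (unique-split beforeᵤ (subst Unique u-chain≡ (chain-unique (rank u) u))) z∈beforeᵤ
    rank-bound : ∀ {z} → z ∈ vs → rank z ≤ rank u ⊔ rank w
    rank-bound z∈ with ∈-++⁻ beforeᵤ z∈
    ... | inj₁ z∈u = ≤-trans (chain-rank (rank u) u (in-u-chain z∈u)) (m≤m⊔n (rank u) (rank w))
    ... | inj₂ z∈w = ≤-trans (chain-rank (rank w) w (in-w-chain z∈w)) (m≤n⊔m (rank u) (rank w))

  cycle-through-parents : ∀ {x y} → Adj G x y → x ≢ r → y ≢ r → rank (parent y) < rank x → rank x < rank y →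
    ∃[ a ] ∃[ W ] OpenWalk a a W × Unique W × x ∈ W × y ∈ W × parent x ∈ W × parent y ∈ W
  cycle-through-parents {x} {y} xy x≢r y≢r q<x x<y with treePath (parent y) (parent x)
  ... | vs , path , unique-vs , rank-bound =
    y , y ∷ (vs ++ [ x ]) , cycle , unique-W ,
    there (∈-++⁺ʳ vs (here refl)) , here refl , there (∈-++⁺ˡ (walk-end path)) , there (∈-++⁺ˡ (walk-start path))
    where
    below-x : ∀ {z} → z ∈ vs → rank z < rank x
    below-x z∈ = ≤-<-trans (rank-bound z∈) (⊔-lub q<x (parent-rank x≢r))
    cycle : OpenWalk y y (y ∷ (vs ++ [ x ]))
    cycle = hop (adj-sym G (parent-adjacent y≢r))
      (walk-extend (openWalk-++-walk (walk-extend path (parent-adjacent x≢r)) stop) xy)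
    unique-W : Unique (y ∷ (vs ++ [ x ]))
    unique-W = ¬Any⇒All¬ _ y∉ ∷ unique-++ vs unique-vs ([] ∷ []) λ { z∈ (here refl) → <-irrefl refl (below-x z∈) }
      where
      y∉ : y ∉ vs ++ [ x ]
      y∉ y∈ with ∈-++⁻ vs y∈
      ... | inj₁ y∈vs       = <-asym (below-x y∈vs) x<y
      ... | inj₂ (here y≡x) = <-irrefl (cong rank (sym y≡x)) x<y

  nontree-edge-siblings : EveryBlockClique G → ∀ {x y} → Adj G x y → x ≢ r → y ≢ r →
    rank (parent y) < rank x → rank x < rank y → parent x ≡ parent y
  nontree-edge-siblings blocksCliques {x} {y} xy x≢r y≢r q<x x<y with cycle-through-parents xy x≢r y≢r q<x x<y
  ... | _ , W , cycle , unique-W , x∈W , y∈W , p∈W , q∈W =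
    decidable-stable (parent x ≟ parent y) λ p≢q →
      noCutVertex-clique blocksCliques (_∈? W) (cycle-noCutVertex cycle unique-W) λ clique →
        p≢q (rank-injective (≤-antisym
          (parent-earliest x≢r (clique _ _ q∈W x∈W λ q≡x → <-irrefl (cong rank q≡x) q<x))
          (parent-earliest y≢r (clique _ _ p∈W y∈W λ p≡y → <-asym (parent-rank x≢r) (subst (λ z → rank x < rank z) (sym p≡y) x<y)))))

  later-nonroot : ∀ {x y} → Adj G x y → rank x < rank y → y ≢ r
  later-nonroot {x} xy x<y refl = <-asym x<y (root-first x λ { refl → adj-irrefl G xy })

  parent-of-later-endpoint : EveryBlockClique G → ∀ {x y} → Adj G x y → rank x < rank y →
    parent y ≡ x ⊎ (x ≢ r × parent y ≡ parent x)
  parent-of-later-endpoint blocksCliques {x} {y} xy x<y with parent y ≟ x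
  ... | yes q≡x = inj₁ q≡x
  ... | no  q≢x = inj₂ (x≢r , sym (nontree-edge-siblings blocksCliques xy x≢r y≢r q<x x<y))
    where
    y≢r = later-nonroot xy x<y
    q<x : rank (parent y) < rank x
    q<x = ≤∧≢⇒< (parent-earliest y≢r xy) (q≢x ∘ rank-injective)
    x≢r : x ≢ r
    x≢r refl = <-asym q<x (root-first (parent y) q≢x)

  edge-kind : EveryBlockClique G → ∀ {u v} → Adj G u v → ParentOrSibling r parent u v
  edge-kind blocksCliques {u} {v} uv with <-cmp (rank u) (rank v)
  ... | tri≈ _ u≈v _ = ⊥-elim (adj-irrefl G (subst (Adj G u) (sym (rank-injective u≈v)) uv))
  ... | tri< u<v _ _ with parent-of-later-endpoint blocksCliques uv u<v
  ...   | inj₁ pv≡u          = toChild (later-nonroot uv u<v) pv≡u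
  ...   | inj₂ (u≢r , pv≡pu) = toSibling u≢r (later-nonroot uv u<v) (sym pv≡pu)
  edge-kind blocksCliques {u} {v} uv | tri> _ _ v<u with parent-of-later-endpoint blocksCliques (adj-sym G uv) v<u
  ...   | inj₁ pu≡v          = toParent (later-nonroot (adj-sym G uv) v<u) pu≡v
  ...   | inj₂ (v≢r , pu≡pv) = toSibling (later-nonroot (adj-sym G uv) v<u) v≢r pu≡pv

mainTheorem4 : ∀ {n} (G T : SimpleGraph n) (r : Fin n) →
    Connected G → EveryBlockClique G → IsBFSTree G r T →
    ∀ (k : ℕ) → 1 ≤ k → ∀ (m : ℕ) →
    (IsPebblingNumber G r k m → IsPebblingNumber T r k m) ×
    (IsPebblingNumber T r k m → IsPebblingNumber G r k m)
mainTheorem4 G T r _ blocksCliques (pos , pos-injective , root-first , has-parent , _ , tree-edges) k _ m =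
  SiblingPebbling.same-pebblingNumbers G T r rank rank-injective (λ v → toℕ<n (pos v))
    parent parent-rank tree-parent tree⊆G (edge-kind blocksCliques)
  where
  open BFSOrder G r pos pos-injective root-first has-parent
  tree-parent : ∀ {v} → v ≢ r → Adj T v (parent v)
  tree-parent {v} v≢r = proj₂ (tree-edges v (parent v)) (inj₁ (v≢r , proj₁ (parent-spec v≢r)))
  tree⊆G : ∀ {u v} → Adj T u v → Adj G u v
  tree⊆G {u} {v} uv with proj₁ (tree-edges u v) uv
  ... | inj₁ (_ , vu , _) = adj-sym G vu
  ... | inj₂ (_ , uv′ , _) = uv′
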